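{- Let $p$ be a prime, $n\ge1$, $G = \langle e_1\rangle\oplus\langle e_2\rangle$ with $\operatorname{ord}(e_1)=p$, $\operatorname{ord}(e_2)=pn$, $K$ a splitting field of $G$, $\zeta\in K$ a primitive $pn$-th root of unity, and $\psi,\varphi\in\widehat G$ defined by $\psi(e_1)=\zeta^n$, $\psi(e_2)=1$, $\varphi(e_1)=1$, $\varphi(e_2)=\zeta$. Let $g\in\{ke_1+ple_2: k\in[0,p-1],\ l\in\mathbb N_0\}$. Then \[ \langle\psi,\varphi^n\rangle\subset\bigcup_{i=0}^{p-1}\langle ie_1+e_2\rangle^\perp\ \cup\ \langle g\rangle^\perp. \]
   Context: $[a,b]=\{x\in\mathbb Z: a\le x\le b\}$, $\mathbb N_0$ the nonnegative integers. A field $K$ is a splitting field of $G$ if the group of $\exp(G)$-th roots of unity in $K$ has exactly $\exp(G)$ elements. $\widehat G=\operatorname{Hom}(G,K^\times)$ is the character group. For a subgroup $U\subset G$, $U^\perp=\{\chi\in\widehat G:\chi(u)=1\ \forall u\in U\}$. -}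

module Defs where

open import Level using (_⊔_) renaming (suc to lsuc)
open import Data.Nat using (ℕ; zero; suc; _<_; NonZero) renaming (_+_ to _+ℕ_; _*_ to _*ℕ_)
open import Data.Nat.Properties using (m*n≢0)
open import Data.Nat.DivMod using (_mod_)
open import Data.Fin using (Fin; toℕ)
open import Data.Product using (_×_; _,_; ∃; Σ)
open import Algebra.Bundles using (CommutativeRing)
open import Relation.Nullary using (¬_)
open import Relation.Binary.PropositionalEquality using (_≡_)

record Field c ℓ : Set (lsuc (c ⊔ ℓ)) where
  field
    commutativeRing : CommutativeRing c ℓ
  open CommutativeRing commutativeRing public
  field
    1≉0     : ¬ (1# ≈ 0#)
    inverse : ∀ x → ¬ (x ≈ 0#) → ∃ λ y → x * y ≈ 1#

module Setup {c ℓ} (K : Field c ℓ) (p n : ℕ) .{{_ : NonZero p}} .{{_ : NonZero n}} where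
  open Field K public

  private
    instance
      pn≢0 : NonZero (p *ℕ n)
      pn≢0 = m*n≢0 p n

  infixr 8 _^_
  _^_ : Carrier → ℕ → Carrier
  x ^ zero  = 1#
  x ^ suc k = x * (x ^ k)

  -- the group G (elements (a , b) stand for a e₁ + b e₂)
  G : Set
  G = Fin p × Fin (p *ℕ n)

  infixl 6 _⊕_
  _⊕_ : G → G → G
  (a , b) ⊕ (a′ , b′) = ((toℕ a +ℕ toℕ a′) mod p , (toℕ b +ℕ toℕ b′) mod (p *ℕ n))

  0G : G
  0G = (0 mod p , 0 mod (p *ℕ n))

  infixr 7 _·_
  _·_ : ℕ → G → G
  zero  · x = 0G
  suc k · x = x ⊕ (k · x)

  e₁ e₂ : G
  e₁ = (1 mod p , 0 mod (p *ℕ n))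
  e₂ = (0 mod p , 1 mod (p *ℕ n))

  IsCharacter : (G → Carrier) → Set ℓ
  IsCharacter χ = (χ 0G ≈ 1#) × (∀ x y → χ (x ⊕ y) ≈ χ x * χ y)

  IsPrimitiveRoot : ℕ → Carrier → Set ℓ
  IsPrimitiveRoot m ζ = (ζ ^ m ≈ 1#) × (∀ j → 0 < j → j < m → ¬ (ζ ^ j ≈ 1#))

  -- the group of m-th roots of unity in K has exactly m elements
  IsSplittingField : ℕ → Set (c ⊔ ℓ)
  IsSplittingField m =
    Σ (Fin m → Carrier) λ f →
      (∀ i → f i ^ m ≈ 1#) ×
      (∀ i j → f i ≈ f j → i ≡ j) ×
      (∀ x → x ^ m ≈ 1# → ∃ λ i → x ≈ f i)

  -- χ ∈ ⟨ ψ , θ ⟩ (subgroup of the finite group Ĝ generated by ψ and θ)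
  _∈⟨_,_⟩ : (G → Carrier) → (G → Carrier) → (G → Carrier) → Set ℓ
  χ ∈⟨ ψ , θ ⟩ = ∃ λ a → ∃ λ b → ∀ x → χ x ≈ (ψ x ^ a) * (θ x ^ b)

  _∈⟨_⟩⊥ : (G → Carrier) → G → Set ℓ
  χ ∈⟨ h ⟩⊥ = ∀ m → χ (m · h) ≈ 1#

module Submission where

-- Write χ = ψ^a (φⁿ)^b and h = x e₁ + y e₂.  Since ψ = (ζⁿ, 1) and φ = (1, ζ)
-- on the generators (e₁, e₂), every character value is a power of ζ:
-- χ (m h) = ζ^(n m (x a + y b)).  As ζ^(pn) = 1, χ annihilates ⟨h⟩ as soon
-- as p ∣ x a + y b.  So the lemma reduces to arithmetic modulo the prime p:
--   * if p ∣ a, then h = k e₁ + p l e₂ works, since p ∣ k a + p l b;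
--   * if p ∤ a, the congruence i a + b ≡ 0 (mod p) has a solution i < p
--     (via Bézout), so h = i e₁ + e₂ works.

open import Defs
open import Level using (Level; _⊔_)
open import Data.Nat using (ℕ; zero; suc; NonZero) renaming (_+_ to _+ℕ_; _*_ to _*ℕ_)
open import Data.Nat.Divisibility
open import Data.Nat.DivMod using (_mod_; _%_; _/_; m≡m%n+[m/n]*n; m%n<n)
open import Data.Nat.Primality using (Prime; prime⇒irreducible)
open import Data.Nat.Coprimality as Coprime using (Coprime; coprime-Bézout)
open import Data.Nat.GCD using (module Bézout)
open import Data.Nat.Tactic.RingSolver using (solve)
open import Data.Fin using (Fin; toℕ)
open import Data.Fin.Properties using (toℕ-fromℕ<)
open import Data.List using (_∷_; [])
open import Data.Product using (∃; _,_)
open import Data.Sum as Sum using (_⊎_; inj₁; inj₂)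
open import Relation.Nullary using (¬_; yes; no; contradiction)
open import Relation.Binary.PropositionalEquality as ≡ using (_≡_; cong; subst)
import Algebra.Properties.Semiring.Exp as Exp

module Arithmetic where
  open import Data.Nat using (_+_; _*_)
  open import Data.Nat.Properties using (*-assoc; *-identityˡ)
  open ≡ using (refl; sym)
  open ≡.≡-Reasoning

  prime∤⇒coprime : ∀ {p a} → Prime p → ¬ p ∣ a → Coprime p a
  prime∤⇒coprime pr p∤a (d∣p , d∣a) with prime⇒irreducible pr d∣p
  ... | inj₁ d≡1 = d≡1
  ... | inj₂ refl = contradiction d∣a p∤a

  -- Modulo a prime p, every a ≢ 0 has a "negative inverse" y, i.e. y·a ≡ -1.
  -- Bézout gives x·a ≡ 1 or x·a ≡ -1; in the first case y = (p-1)·x works.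
  negative-inverse : ∀ p .{{_ : NonZero p}} {a} → Prime p → ¬ p ∣ a → ∃ λ y → p ∣ 1 + y * a
  negative-inverse (suc p′) {a} pr p∤a with coprime-Bézout (Coprime.sym (prime∤⇒coprime pr p∤a))
  ... | Bézout.-+ x y 1+xa≡yp = x , divides y 1+xa≡yp
  ... | Bézout.+- x y 1+yp≡xa = p′ * x , divides (1 + p′ * y) (begin
      1 + p′ * x * a            ≡⟨ cong suc (*-assoc p′ x a) ⟩
      1 + p′ * (x * a)          ≡⟨ cong (λ t → 1 + p′ * t) 1+yp≡xa ⟨
      1 + p′ * (1 + y * suc p′) ≡⟨ solve (p′ ∷ y ∷ []) ⟩
      (1 + p′ * y) * suc p′     ∎)

  residue-suffices : ∀ p .{{_ : NonZero p}} x a b → p ∣ x * a + b → p ∣ toℕ (x mod p) * a + b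
  residue-suffices p x a b p∣xa+b = ∣m+n∣m⇒∣n (subst (p ∣_) split p∣xa+b) (n∣m*n*o (x / p) a)
    where
    regroup : ∀ r q → (r + q * p) * a + b ≡ q * p * a + (r * a + b)
    regroup r q = solve (r ∷ q ∷ p ∷ a ∷ b ∷ [])
    split : x * a + b ≡ x / p * p * a + (toℕ (x mod p) * a + b)
    split = begin
      x * a + b                         ≡⟨ cong (λ t → t * a + b) (m≡m%n+[m/n]*n x p) ⟩
      (x % p + x / p * p) * a + b       ≡⟨ regroup (x % p) (x / p) ⟩
      x / p * p * a + (x % p * a + b)   ≡⟨ cong (λ r → x / p * p * a + (r * a + b)) (toℕ-fromℕ< (m%n<n x p)) ⟨
      x / p * p * a + (toℕ (x mod p) * a + b) ∎

  -- The congruence i·a + b ≡ 0 (mod p) is solvable for p prime, p ∤ a: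
  -- with y·a ≡ -1, take i = y·b mod p.
  linear-congruence : ∀ p .{{_ : NonZero p}} {a} → Prime p → ¬ p ∣ a → ∀ b → ∃ λ (i : Fin p) → p ∣ toℕ i * a + b
  linear-congruence p {a} pr p∤a b with negative-inverse p pr p∤a
  ... | y , p∣1+ya = (y * b) mod p , residue-suffices p (y * b) a b (subst (p ∣_) expand (∣n⇒∣m*n b p∣1+ya))
    where
    expand : b * (1 + y * a) ≡ y * b * a + b
    expand = solve (b ∷ y ∷ a ∷ [])

  annihilating-coefficients : ∀ p .{{_ : NonZero p}} → Prime p → ∀ a b (k : Fin p) l →
    (∃ λ (i : Fin p) → p ∣ toℕ i * a + 1 * b) ⊎ p ∣ toℕ k * a + p * l * b
  annihilating-coefficients p pr a b k l with p ∣? a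
  ... | yes p∣a = inj₂ (∣m∣n⇒∣m+n (∣n⇒∣m*n (toℕ k) p∣a) (∣m⇒∣m*n b (m∣m*n l)))
  ... | no p∤a with linear-congruence p pr p∤a b
  ...   | i , p∣ia+b = inj₁ (i , subst (λ t → p ∣ toℕ i * a + t) (sym (*-identityˡ b)) p∣ia+b)

module CharacterValues {c ℓ} (K : Field c ℓ) (p n : ℕ) .{{_ : NonZero p}} .{{_ : NonZero n}} where
  open Setup K p n renaming (_^_ to _^ᴷ_)
  open Exp semiring using (_^_; ^-congˡ; ^-homo-*; ^-assocʳ)
  open import Relation.Binary.Reasoning.Setoid setoid

  ^ᴷ≈^ : ∀ x m → x ^ᴷ m ≈ x ^ m
  ^ᴷ≈^ x zero    = refl
  ^ᴷ≈^ x (suc m) = *-congˡ (^ᴷ≈^ x m)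

  power-of-multiple : ∀ {x} N → x ^ N ≈ 1# → ∀ {E} → N ∣ E → x ^ E ≈ 1#
  power-of-multiple {x} N xᴺ≈1 (divides q ≡.refl) = x^qN≈1 q
    where
    x^qN≈1 : ∀ q → x ^ (q *ℕ N) ≈ 1#
    x^qN≈1 zero    = refl
    x^qN≈1 (suc q) = begin
      x ^ (N +ℕ q *ℕ N)   ≈⟨ ^-homo-* x N (q *ℕ N) ⟩
      x ^ N * x ^ (q *ℕ N) ≈⟨ *-cong xᴺ≈1 (x^qN≈1 q) ⟩
      1# * 1#             ≈⟨ *-identityˡ 1# ⟩
      1#                  ∎

  character-multiple : ∀ {χ} → IsCharacter χ → ∀ m g → χ (m · g) ≈ χ g ^ m
  character-multiple (χ0≈1 , _)     zero    g = χ0≈1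
  character-multiple χ@(_ , χ-hom) (suc m) g =
    trans (χ-hom g (m · g)) (*-congˡ (character-multiple χ m g))

  HasCoordinates : G → ℕ → ℕ → Set (c ⊔ ℓ)
  HasCoordinates h x y = ∀ {χ} → IsCharacter χ → χ h ≈ χ e₁ ^ x * χ e₂ ^ y

  -- The two kinds of subgroup generators in the lemma have the expected
  -- coordinates; note x e₁ + e₂ is not definitionally x e₁ + 1 e₂.
  coordinates : ∀ x y → HasCoordinates (x · e₁ ⊕ y · e₂) x y
  coordinates x y χ-char@(_ , χ-hom) =
    trans (χ-hom (x · e₁) (y · e₂))
          (*-cong (character-multiple χ-char x e₁) (character-multiple χ-char y e₂))

  coordinates-e₂ : ∀ x → HasCoordinates (x · e₁ ⊕ e₂) x 1
  coordinates-e₂ x χ-char@(_ , χ-hom) =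
    trans (χ-hom (x · e₁) e₂)
          (*-cong (character-multiple χ-char x e₁) (sym (*-identityʳ _)))

  character-value : ∀ {χ} → IsCharacter χ → ∀ ζ A B → χ e₁ ≈ ζ ^ A → χ e₂ ≈ ζ ^ B →
    ∀ {h} x y → HasCoordinates h x y → ∀ m → χ (m · h) ≈ ζ ^ ((A *ℕ x +ℕ B *ℕ y) *ℕ m)
  character-value {χ} χ-char ζ A B χe₁ χe₂ {h} x y h-coords m = begin
    χ (m · h)                           ≈⟨ character-multiple χ-char m h ⟩
    χ h ^ m                             ≈⟨ ^-congˡ m (h-coords χ-char) ⟩
    (χ e₁ ^ x * χ e₂ ^ y) ^ m           ≈⟨ ^-congˡ m (*-cong (^-congˡ x χe₁) (^-congˡ y χe₂)) ⟩
    ((ζ ^ A) ^ x * (ζ ^ B) ^ y) ^ m     ≈⟨ ^-congˡ m (*-cong (^-assocʳ ζ A x) (^-assocʳ ζ B y)) ⟩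
    (ζ ^ (A *ℕ x) * ζ ^ (B *ℕ y)) ^ m   ≈⟨ ^-congˡ m (^-homo-* ζ (A *ℕ x) (B *ℕ y)) ⟨
    (ζ ^ (A *ℕ x +ℕ B *ℕ y)) ^ m        ≈⟨ ^-assocʳ ζ (A *ℕ x +ℕ B *ℕ y) m ⟩
    ζ ^ ((A *ℕ x +ℕ B *ℕ y) *ℕ m)       ∎

  module Annihilation
    (ζ : Carrier) (ζ^pn≈1 : ζ ^ᴷ (p *ℕ n) ≈ 1#)
    (ψ φ : G → Carrier) (ψ-char : IsCharacter ψ) (φ-char : IsCharacter φ)
    (ψe₁ : ψ e₁ ≈ ζ ^ᴷ n) (ψe₂ : ψ e₂ ≈ 1#) (φe₁ : φ e₁ ≈ 1#) (φe₂ : φ e₂ ≈ ζ)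
    (χ : G → Carrier) (a b : ℕ) (χ≈ : ∀ g → χ g ≈ (ψ g ^ᴷ a) * ((φ g ^ᴷ n) ^ᴷ b))
    where

    χ-value : ∀ {h} x y → HasCoordinates h x y → ∀ m → χ (m · h) ≈ ζ ^ ((x *ℕ a +ℕ y *ℕ b) *ℕ n *ℕ m)
    χ-value {h} x y h-coords m = begin
      χ (m · h)                                  ≈⟨ χ≈ (m · h) ⟩
      ψ (m · h) ^ᴷ a * (φ (m · h) ^ᴷ n) ^ᴷ b      ≈⟨ *-cong (^ᴷ≈^ _ a) (trans (^ᴷ≈^ _ b) (^-congˡ b (^ᴷ≈^ _ n))) ⟩
      ψ (m · h) ^ a * (φ (m · h) ^ n) ^ b        ≈⟨ *-cong (^-congˡ a ψ-value) (^-congˡ b (^-congˡ n φ-value)) ⟩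
      (ζ ^ Eψ) ^ a * ((ζ ^ Eφ) ^ n) ^ b          ≈⟨ *-cong (^-assocʳ ζ Eψ a) (trans (^-congˡ b (^-assocʳ ζ Eφ n)) (^-assocʳ ζ (Eφ *ℕ n) b)) ⟩
      ζ ^ (Eψ *ℕ a) * ζ ^ (Eφ *ℕ n *ℕ b)         ≈⟨ ^-homo-* ζ (Eψ *ℕ a) (Eφ *ℕ n *ℕ b) ⟨
      ζ ^ (Eψ *ℕ a +ℕ Eφ *ℕ n *ℕ b)              ≡⟨ ≡.cong (ζ ^_) exponent ⟩
      ζ ^ ((x *ℕ a +ℕ y *ℕ b) *ℕ n *ℕ m)         ∎
      where
      Eψ Eφ : ℕ
      Eψ = (n *ℕ x +ℕ 0 *ℕ y) *ℕ m
      Eφ = (0 *ℕ x +ℕ 1 *ℕ y) *ℕ m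
      ψ-value : ψ (m · h) ≈ ζ ^ Eψ
      ψ-value = character-value ψ-char ζ n 0 (trans ψe₁ (^ᴷ≈^ ζ n)) ψe₂ x y h-coords m
      φ-value : φ (m · h) ≈ ζ ^ Eφ
      φ-value = character-value φ-char ζ 0 1 φe₁ (trans φe₂ (sym (*-identityʳ ζ))) x y h-coords m
      exponent : (n *ℕ x +ℕ 0 *ℕ y) *ℕ m *ℕ a +ℕ (0 *ℕ x +ℕ 1 *ℕ y) *ℕ m *ℕ n *ℕ b ≡ (x *ℕ a +ℕ y *ℕ b) *ℕ n *ℕ m
      exponent = solve (x ∷ y ∷ a ∷ b ∷ n ∷ m ∷ [])

    -- χ annihilates ⟨h⟩ as soon as h has coordinates (x, y) with p ∣ x a + y b,
    -- because then pn divides the exponent of ζ in every χ (m h).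
    annihilates : ∀ {h} x y → HasCoordinates h x y → p ∣ x *ℕ a +ℕ y *ℕ b → χ ∈⟨ h ⟩⊥
    annihilates x y h-coords p∣xa+yb m = trans (χ-value x y h-coords m)
      (power-of-multiple (p *ℕ n) (trans (sym (^ᴷ≈^ ζ (p *ℕ n))) ζ^pn≈1) (∣m⇒∣m*n m (*-monoˡ-∣ n p∣xa+yb)))

lemma3p6 : ∀ {c ℓ : Level} (K : Field c ℓ) (p n : ℕ) .{{_ : NonZero p}} .{{_ : NonZero n}} →
    Prime p →
    let open Setup K p n in
    IsSplittingField (p *ℕ n) →
    (ζ : Carrier) → IsPrimitiveRoot (p *ℕ n) ζ →
    (ψ φ : G → Carrier) → IsCharacter ψ → IsCharacter φ →
    ψ e₁ ≈ ζ ^ n → ψ e₂ ≈ 1# → φ e₁ ≈ 1# → φ e₂ ≈ ζ →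
    (k : Fin p) (l : ℕ) →
    (χ : G → Carrier) → χ ∈⟨ ψ , (λ x → φ x ^ n) ⟩ →
    (∃ λ (i : Fin p) → χ ∈⟨ toℕ i · e₁ ⊕ e₂ ⟩⊥) ⊎ χ ∈⟨ toℕ k · e₁ ⊕ (p *ℕ l) · e₂ ⟩⊥
lemma3p6 K p n p-prime _ ζ (ζ^pn≈1 , _) ψ φ ψ-char φ-char ψe₁ ψe₂ φe₁ φe₂ k l χ (a , b , χ≈) =
  Sum.map (λ (i , p∣ia+b) → i , annihilates (toℕ i) 1 (coordinates-e₂ (toℕ i)) p∣ia+b)
          (annihilates (toℕ k) (p *ℕ l) (coordinates (toℕ k) (p *ℕ l)))
          (annihilating-coefficients p p-prime a b k l)
  where
  open Arithmetic using (annihilating-coefficients)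
  open CharacterValues K p n
  open Annihilation ζ ζ^pn≈1 ψ φ ψ-char φ-char ψe₁ ψe₂ φe₁ φe₂ χ a b χ≈
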